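{- Let $G$ be a graph of order $n\ge 2$ with at least one edge. The following are equivalent: (1) $G$ is a tree; (2) $\operatorname{z_+ir}(G)=1$; (3) $\operatorname{Z}_+(G)=1$; (4) $\overline{\operatorname{Z}}_+(G)=1$; (5) $\operatorname{Z_+IR}(G)=1$.
   Context: Graphs are finite, simple, undirected. PSD color change rule: given a set $B$ of blue vertices (the rest white), let $W_1,\dots,W_k$ be the vertex sets of the connected components of $G-B$; if $u\in B$, $w\in W_i$, and $w$ is the only white neighbor of $u$ in $G[W_i\cup B]$, then $u$ can change $w$ to blue. A PSD forcing set is a set $S$ such that starting with exactly $S$ blue and applying the rule repeatedly until no change is possible colors all of $V(G)$ blue. $\operatorname{Z}_+(G)$ is the minimum cardinality of a PSD forcing set, and $\overline{\operatorname{Z}}_+(G)$ the maximum cardinality of a minimal (w.r.t. inclusion) PSD forcing set. A (standard) fort is a nonempty $F\subseteq V(G)$ with $|F\cap N(v)|\ne 1$ for all $v\notin F$; a nonempty $F$ is a PSD fort if the vertex set of each connected component of $G[F]$ is a standard fort of $G$. $S\subseteq V(G)$ is a $\operatorname{Z}_+$Ir-set if each $u\in S$ has a PSD fort $F$ with $S\cap F=\{u\}$. $\operatorname{Z_+IR}(G)$ is the maximum cardinality of a $\operatorname{Z}_+$Ir-set, and $\operatorname{z_+ir}(G)$ the minimum cardinality of a maximal (w.r.t. inclusion) $\operatorname{Z}_+$Ir-set. -}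

module Defs where

open import Data.Nat using (ℕ; suc; _≤_)
open import Data.Bool using (Bool; true; false)
open import Data.Fin using (Fin; zero; suc; inject₁; fromℕ)
open import Data.Fin.Subset using (Subset; ⊤; _∈_; _∉_; _⊆_; _∪_; _∩_; ⁅_⁆; ∣_∣)
open import Data.Product using (Σ; ∃; ∃-syntax; _×_; _,_)
open import Data.Unit using () renaming (⊤ to Unit)
open import Relation.Nullary using (¬_)
open import Relation.Binary.PropositionalEquality using (_≡_)
open import Function.Definitions using (Injective)

record Graph (n : ℕ) : Set where
  field
    adj    : Fin n → Fin n → Bool
    sym    : ∀ i j → adj i j ≡ adj j i
    irrefl : ∀ i → adj i i ≡ false

module _ {n : ℕ} (G : Graph n) where
  open Graph G

  E : Fin n → Fin n → Set
  E i j = adj i j ≡ true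

  HasEdge : Set
  HasEdge = ∃[ i ] ∃[ j ] E i j

  data ReachIn (P : Fin n → Set) : Fin n → Fin n → Set where
    here : ∀ {x} → P x → ReachIn P x x
    step : ∀ {x z y} → P x → E x z → ReachIn P z y → ReachIn P x y

  Connected : Set
  Connected = ∀ u v → ReachIn (λ _ → Unit) u v

  -- A cycle: distinct vertices v₀,…,v_{k+2} (length ≥ 3), consecutive ones
  -- adjacent, and the last adjacent to the first.
  Cycle : Set
  Cycle = Σ ℕ λ k → Σ (Fin (suc (suc (suc k))) → Fin n) λ v →
            Injective _≡_ _≡_ v
          × (∀ (i : Fin (suc (suc k))) → E (v (inject₁ i)) (v (suc i)))
          × E (v (fromℕ (suc (suc k)))) (v zero)

  IsTree : Set
  IsTree = Connected × ¬ Cycle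

  WhiteComp : Subset n → Fin n → Fin n → Set
  WhiteComp B w x = ReachIn (λ y → y ∉ B) w x

  -- One PSD force: some blue u changes white w to blue, where w is the only
  -- white neighbour of u in G[W ∪ B], W the component of G - B containing w.
  data PSDForce (B : Subset n) : Subset n → Set where
    force : ∀ (u w : Fin n) → u ∈ B → w ∉ B → E u w →
            (∀ x → WhiteComp B w x → E u x → x ≡ w) →
            PSDForce B (B ∪ ⁅ w ⁆)

  data PSDReach : Subset n → Subset n → Set where
    done : ∀ {B} → PSDReach B B
    more : ∀ {B C D} → PSDForce B C → PSDReach C D → PSDReach B D

  full : Subset n
  full = ⊤

  IsPSDForcingSet : Subset n → Set
  IsPSDForcingSet S = PSDReach S full

  IsFort : (Fin n → Set) → Set
  IsFort F = (∃[ x ] F x) ×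
             (∀ v → ¬ F v → ¬ (∃[ w ] (F w × E v w × (∀ w' → F w' → E v w' → w' ≡ w))))

  -- PSD fort: nonempty, and the vertex set of each connected component of G[F]
  -- (the component of x ∈ F is {y | ReachIn F x y}) is a standard fort.
  IsPSDFort : Subset n → Set
  IsPSDFort F = (∃[ x ] x ∈ F) ×
                (∀ x → x ∈ F → IsFort (λ y → ReachIn (λ z → z ∈ F) x y))

  IsZIrSet : Subset n → Set
  IsZIrSet S = ∀ u → u ∈ S → ∃[ F ] (IsPSDFort F × S ∩ F ≡ ⁅ u ⁆)

-- Extremal cardinalities, as relations "the min/max of |S| over P is k".
module _ {n : ℕ} where
  Minimal : (Subset n → Set) → Subset n → Set
  Minimal P S = P S × (∀ T → T ⊆ S → P T → T ≡ S)

  Maximal : (Subset n → Set) → Subset n → Set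
  Maximal P S = P S × (∀ T → S ⊆ T → P T → T ≡ S)

  MinCardIs : (Subset n → Set) → ℕ → Set
  MinCardIs P k = (∃[ S ] (P S × ∣ S ∣ ≡ k)) × (∀ S → P S → k ≤ ∣ S ∣)

  MaxCardIs : (Subset n → Set) → ℕ → Set
  MaxCardIs P k = (∃[ S ] (P S × ∣ S ∣ ≡ k)) × (∀ S → P S → ∣ S ∣ ≤ k)

module _ {n : ℕ} (G : Graph n) where
  Zplus≡ : ℕ → Set
  Zplus≡ k = MinCardIs (IsPSDForcingSet G) k

  ZplusBar≡ : ℕ → Set
  ZplusBar≡ k = MaxCardIs (Minimal (IsPSDForcingSet G)) k

  ZplusIR≡ : ℕ → Set
  ZplusIR≡ k = MaxCardIs (IsZIrSet G) k

  zplusir≡ : ℕ → Set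
  zplusir≡ k = MinCardIs (Maximal (IsZIrSet G)) k

{-# OPTIONS --safe #-}
-- Forcing from a single vertex y keeps the blue set B a tree containing y such that each white
-- component is adjacent to at most one vertex of B; hence a singleton PSD forcing set makes G a
-- tree. Conversely, in a tree every vertex forces the whole graph, so every PSD fort is all of
-- V(G) and every Z₊Ir-set has at most one element.
--
-- If G is not a tree, let B ≠ V(G) be a stalled colouring reached from {u}. The complement of a
-- stalled colouring is a PSD fort, so {u, v} is a Z₊Ir-set as soon as v ∉ B and a stalled
-- colouring reached from {v} misses u. Such a v exists: either a vertex not connected to u, or a
-- white neighbour v of some b ∈ B. In the latter case b cannot force v, so b has a second
-- neighbour in the white component of v; forcing from v therefore never colours b, and so never
-- enters B.
module Submission where

open import Defs
open import Data.Nat using (ℕ; zero; suc; _≤_; _<_; _∸_; z≤n; s≤s)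
open import Data.Nat.Properties using (<⇒≤; <⇒≱; <-irrefl; ≤-reflexive; ∸-monoʳ-<)
open import Data.Nat.Induction using (<-wellFounded)
open import Data.Bool using (true)
import Data.Bool.Properties as Bool
open import Data.Fin using (Fin; zero; suc; inject₁; fromℕ; _≟_)
open import Data.Fin.Properties using (any?; all?; ¬∀⟶∃¬; suc-injective; injective⇒≤)
open import Data.Fin.Subset using (Subset; _∈_; _∉_; _⊆_; _∪_; _∩_; ⁅_⁆; ∣_∣; ⊤; ∁; Nonempty)
open import Data.Fin.Subset.Properties
  using (_∈?_; ∈⊤; ⊆⊤; x∈⁅x⁆; x∈⁅y⁆⇒x≡y; ∣⁅x⁆∣≡1; ⊆-antisym; p⊆q⇒∣p∣≤∣q∣; p⊂q⇒∣p∣<∣q∣;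
         x∈∁p⇒x∉p; x∉p⇒x∈∁p; x∈p∩q⁺; x∈p∩q⁻; p⊆p∪q; q⊆p∪q; x∈p∪q⁻; x∈p∪q⁺; ∣p∣≤n; ∪-comm;
         nonempty?; Empty-unique; ∣⊥∣≡0)
open import Data.Vec using (Vec; []; _∷_; lookup)
open import Data.Vec.Relation.Unary.All as All using (All; []; _∷_)
open import Data.Vec.Relation.Unary.AllPairs using ([]; _∷_)
open import Data.Vec.Relation.Unary.Unique.Propositional using (Unique)
open import Data.Vec.Relation.Unary.Unique.Propositional.Properties using (lookup-injective)
open import Data.Product using (∃; ∃₂; ∃-syntax; _×_; _,_; proj₁; proj₂)
open import Data.Sum using (_⊎_; inj₁; inj₂)
import Data.Sum as Sum
open import Data.Unit using (tt) renaming (⊤ to Unit)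
open import Data.Empty using (⊥; ⊥-elim)
open import Function using (_∘_; flip; case_of_)
open import Function.Bundles using (_⇔_; mk⇔)
open import Induction.WellFounded using (Acc; acc; WellFounded; module Subrelation)
import Relation.Binary.Construct.On as On
open import Relation.Nullary using (¬_; Dec; yes; no; contradiction)
open import Relation.Nullary.Decidable using (map′; decidable-stable; _×-dec_; _⊎-dec_; ¬?)
open import Relation.Nullary.Negation using (¬¬-map)
open import Relation.Unary using (Decidable)
open import Relation.Binary.PropositionalEquality using (_≡_; _≢_; refl; sym; trans; cong; subst)

module _ {n : ℕ} where

  private
    variable
      m : ℕ
      p q : Subset n
      x y : Fin n

  unique⇒length≤n : {vs : Vec (Fin n) m} → Unique vs → m ≤ n
  unique⇒length≤n u = injective⇒≤ (λ {i} {j} → lookup-injective u i j)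

  ∀∈⊎∃∉ : (p : Subset n) → (∀ x → x ∈ p) ⊎ ∃[ x ] x ∉ p
  ∀∈⊎∃∉ p with all? (_∈? p)
  ... | yes all∈ = inj₁ all∈
  ... | no  ¬all = inj₂ (¬∀⟶∃¬ n _ (_∈? p) ¬all)

  Disjoint : Subset n → Subset n → Set
  Disjoint p q = ∀ {x} → x ∈ p → x ∉ q

  x∈p∪⁅y⁆⁻ : x ∈ p ∪ ⁅ y ⁆ → x ∈ p ⊎ x ≡ y
  x∈p∪⁅y⁆⁻ {p = p} {y} x∈ = Sum.map₂ (x∈⁅y⁆⇒x≡y y) (x∈p∪q⁻ p ⁅ y ⁆ x∈)

  x∈p∪⁅x⁆ : x ∈ p ∪ ⁅ x ⁆
  x∈p∪⁅x⁆ {x} = x∈p∪q⁺ (inj₂ (x∈⁅x⁆ x))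

  x∈p⇒⁅x⁆⊆p : x ∈ p → ⁅ x ⁆ ⊆ p
  x∈p⇒⁅x⁆⊆p {x} {p} x∈p y∈⁅x⁆ = subst (_∈ p) (sym (x∈⁅y⁆⇒x≡y x y∈⁅x⁆)) x∈p

  p⊆⁅x⁆⇒p≡⁅x⁆ : p ⊆ ⁅ x ⁆ → y ∈ p → p ≡ ⁅ x ⁆
  p⊆⁅x⁆⇒p≡⁅x⁆ {p} {x} p⊆⁅x⁆ y∈p =
    ⊆-antisym p⊆⁅x⁆ (x∈p⇒⁅x⁆⊆p (subst (_∈ p) (x∈⁅y⁆⇒x≡y x (p⊆⁅x⁆ y∈p)) y∈p))

  p∩q≡⁅x⁆ : x ∈ p → x ∈ q → (∀ {y} → y ∈ p → y ∈ q → y ≡ x) → p ∩ q ≡ ⁅ x ⁆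
  p∩q≡⁅x⁆ {x} {p} {q} x∈p x∈q unique = ⊆-antisym
    (λ y∈p∩q → let (y∈p , y∈q) = x∈p∩q⁻ p q y∈p∩q in subst (_∈ ⁅ x ⁆) (sym (unique y∈p y∈q)) (x∈⁅x⁆ x))
    (x∈p⇒⁅x⁆⊆p (x∈p∩q⁺ (x∈p , x∈q)))

  ⁅x⁆∪⁅y⁆∩∁p≡⁅x⁆ : x ∉ p → y ∈ p → (⁅ x ⁆ ∪ ⁅ y ⁆) ∩ ∁ p ≡ ⁅ x ⁆
  ⁅x⁆∪⁅y⁆∩∁p≡⁅x⁆ {x} {p} {y} x∉p y∈p = p∩q≡⁅x⁆ (p⊆p∪q ⁅ y ⁆ (x∈⁅x⁆ x)) (x∉p⇒x∈∁p x∉p) only-x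
    where
    only-x : ∀ {z} → z ∈ ⁅ x ⁆ ∪ ⁅ y ⁆ → z ∈ ∁ p → z ≡ x
    only-x z∈ z∈∁p with x∈p∪⁅y⁆⁻ z∈
    ... | inj₁ z∈⁅x⁆ = x∈⁅y⁆⇒x≡y x z∈⁅x⁆
    ... | inj₂ refl  = contradiction y∈p (x∈∁p⇒x∉p z∈∁p)

  x∈p⇒1≤∣p∣ : x ∈ p → 1 ≤ ∣ p ∣
  x∈p⇒1≤∣p∣ {x} x∈p = subst (_≤ _) (∣⁅x⁆∣≡1 x) (p⊆q⇒∣p∣≤∣q∣ (x∈p⇒⁅x⁆⊆p x∈p))

  subsingleton⇒∣p∣≤1 : (∀ {x y} → x ∈ p → y ∈ p → x ≡ y) → ∣ p ∣ ≤ 1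
  subsingleton⇒∣p∣≤1 {p} subsingleton with nonempty? p
  ... | yes (x , x∈p) = subst (∣ p ∣ ≤_) (∣⁅x⁆∣≡1 x)
                          (p⊆q⇒∣p∣≤∣q∣ λ y∈p → subst (_∈ ⁅ x ⁆) (subsingleton x∈p y∈p) (x∈⁅x⁆ x))
  ... | no  empty     = subst (_≤ 1) (sym (trans (cong ∣_∣ (Empty-unique empty)) (∣⊥∣≡0 n))) z≤n

  ∣p∣≡1⇒singleton : ∣ p ∣ ≡ 1 → ∃[ x ] p ≡ ⁅ x ⁆
  ∣p∣≡1⇒singleton {p} ∣p∣≡1 with nonempty? p
  ... | no  empty     = case trans (sym ∣p∣≡1) (trans (cong ∣_∣ (Empty-unique empty)) (∣⊥∣≡0 n)) of λ ()
  ... | yes (x , x∈p) = x , p⊆⁅x⁆⇒p≡⁅x⁆ p⊆⁅x⁆ x∈p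
    where
    p⊆⁅x⁆ : p ⊆ ⁅ x ⁆
    p⊆⁅x⁆ {y} y∈p = decidable-stable (y ∈? ⁅ x ⁆) λ y∉⁅x⁆ →
      <-irrefl (trans (∣⁅x⁆∣≡1 x) (sym ∣p∣≡1)) (p⊂q⇒∣p∣<∣q∣ (x∈p⇒⁅x⁆⊆p x∈p , y , y∈p , y∉⁅x⁆))

  1<∣⁅x⁆∪⁅y⁆∣ : y ≢ x → 1 < ∣ ⁅ x ⁆ ∪ ⁅ y ⁆ ∣
  1<∣⁅x⁆∪⁅y⁆∣ {y} {x} y≢x = subst (_< ∣ ⁅ x ⁆ ∪ ⁅ y ⁆ ∣) (∣⁅x⁆∣≡1 x)
    (p⊂q⇒∣p∣<∣q∣ (p⊆p∪q ⁅ y ⁆ , y , q⊆p∪q ⁅ x ⁆ ⁅ y ⁆ (x∈⁅x⁆ y) , y≢x ∘ x∈⁅y⁆⇒x≡y x))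

module _ {n : ℕ} (G : Graph n) where

  private
    variable
      P Q : Fin n → Set
      a b c s t u v w x y z : Fin n
      B C S F : Subset n
      k m : ℕ

  infix 4 _~_
  _~_ : Fin n → Fin n → Set
  _~_ = E G

  ~-sym : x ~ y → y ~ x
  ~-sym {x} {y} e = trans (Graph.sym G y x) e

  ~-irrefl : x ~ y → x ≢ y
  ~-irrefl {x} e refl = case trans (sym e) (Graph.irrefl G x) of λ ()

  _~?_ : ∀ x y → Dec (x ~ y)
  x ~? y = Graph.adj G x y Bool.≟ true

  -- Walks and paths

  reach-head : ReachIn G P x y → P x
  reach-head (here p)     = p
  reach-head (step p _ _) = p

  reach-last : ReachIn G P x y → P y
  reach-last (here p)     = p
  reach-last (step _ _ r) = reach-last r

  reach-map : (∀ {z} → P z → Q z) → ReachIn G P x y → ReachIn G Q x y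
  reach-map f (here p)     = here (f p)
  reach-map f (step p e r) = step (f p) e (reach-map f r)

  reach-snoc : ReachIn G P x y → y ~ v → P v → ReachIn G P x v
  reach-snoc (here p)      e q = step p e (here q)
  reach-snoc (step p e′ r) e q = step p e′ (reach-snoc r e q)

  reach-trans : ReachIn G P x y → ReachIn G P y v → ReachIn G P x v
  reach-trans (here _)     r′ = r′
  reach-trans (step p e r) r′ = step p e (reach-trans r r′)

  reach-sym : ReachIn G P x y → ReachIn G P y x
  reach-sym (here p)     = here p
  reach-sym (step p e r) = reach-snoc (reach-sym r) (~-sym e) p

  reach-exit : ReachIn G Q y t → y ∉ B → t ∈ B →
               ∃₂ λ c b → ReachIn G (λ z → Q z × z ∉ B) y c × c ~ b × b ∈ B × Q b
  reach-exit (here _) y∉B t∈B = ⊥-elim (y∉B t∈B)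
  reach-exit {B = B} (step {z = z} q e r) y∉B t∈B with z ∈? B
  ... | yes z∈B = _ , _ , here (q , y∉B) , e , z∈B , reach-head r
  ... | no  z∉B with reach-exit r z∉B t∈B
  ...   | c , b , r′ , cb , b∈B , qb = c , b , step (q , y∉B) e r′ , cb , b∈B , qb

  infixr 5 _∷⟨_⟩_
  data PathIn (P : Fin n → Set) : Fin n → Fin n → Vec (Fin n) (suc k) → Set where
    [_]    : P a → PathIn P a a (a ∷ [])
    _∷⟨_⟩_ : ∀ {vs : Vec (Fin n) (suc k)} → P a → a ~ c → PathIn P c b vs → PathIn P a b (a ∷ vs)

  data SimplePathIn (P : Fin n → Set) (a b : Fin n) : Set where
    simplePath : {vs : Vec (Fin n) (suc k)} → PathIn P a b vs → Unique vs → SimplePathIn P a b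

  pathIn-head : {vs : Vec (Fin n) (suc k)} → PathIn P a b vs → lookup vs zero ≡ a
  pathIn-head [ _ ]          = refl
  pathIn-head (_ ∷⟨ _ ⟩ _)   = refl

  pathIn-last : {vs : Vec (Fin n) (suc k)} → PathIn P a b vs → lookup vs (fromℕ k) ≡ b
  pathIn-last [ _ ]          = refl
  pathIn-last (_ ∷⟨ _ ⟩ π)   = pathIn-last π

  pathIn-adjacent : {vs : Vec (Fin n) (suc k)} → PathIn P a b vs →
                    ∀ i → lookup vs (inject₁ i) ~ lookup vs (suc i)
  pathIn-adjacent (_ ∷⟨ e ⟩ π) zero    = subst (_ ~_) (sym (pathIn-head π)) e
  pathIn-adjacent (_ ∷⟨ _ ⟩ π) (suc i) = pathIn-adjacent π i

  pathIn-all : {vs : Vec (Fin n) (suc k)} → PathIn P a b vs → All P vs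
  pathIn-all [ p ]        = p ∷ []
  pathIn-all (p ∷⟨ _ ⟩ π) = p ∷ pathIn-all π

  shortcut : {vs : Vec (Fin n) (suc k)} → PathIn P c b vs → Unique vs →
             ∀ a → All (a ≢_) vs ⊎ SimplePathIn P a b
  shortcut {c = c} π u a with a ≟ c
  shortcut π            u       a | yes refl = inj₂ (simplePath π u)
  shortcut [ _ ]        _       a | no a≢c   = inj₁ (a≢c ∷ [])
  shortcut (_ ∷⟨ _ ⟩ π) (_ ∷ u) a | no a≢c   = Sum.map₁ (a≢c ∷_) (shortcut π u a)

  reach⇒simplePath : ReachIn G P a b → SimplePathIn P a b
  reach⇒simplePath (here p) = simplePath [ p ] ([] ∷ [])
  reach⇒simplePath {a = a} (step p e r) with reach⇒simplePath r
  ... | simplePath π u with shortcut π u a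
  ...   | inj₁ a∉π = simplePath (p ∷⟨ e ⟩ π) (a∉π ∷ u)
  ...   | inj₂ σ   = σ

  ReachIn≤ : ℕ → (Fin n → Set) → Fin n → Fin n → Set
  ReachIn≤ zero    P a b = P a × a ≡ b
  ReachIn≤ (suc k) P a b = P a × (a ≡ b ⊎ ∃[ c ] (a ~ c × ReachIn≤ k P c b))

  reachIn≤? : Decidable P → ∀ k a b → Dec (ReachIn≤ k P a b)
  reachIn≤? P? zero    a b = P? a ×-dec (a ≟ b)
  reachIn≤? P? (suc k) a b = P? a ×-dec ((a ≟ b) ⊎-dec any? (λ c → (a ~? c) ×-dec reachIn≤? P? k c b))

  reachIn≤⇒reach : ∀ k → ReachIn≤ k P a b → ReachIn G P a b
  reachIn≤⇒reach zero    (p , refl)              = here p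
  reachIn≤⇒reach (suc k) (p , inj₁ refl)         = here p
  reachIn≤⇒reach (suc k) (p , inj₂ (_ , e , r))  = step p e (reachIn≤⇒reach k r)

  pathIn⇒reachIn≤ : {vs : Vec (Fin n) (suc k)} → PathIn P a b vs → k ≤ m → ReachIn≤ m P a b
  pathIn⇒reachIn≤ {m = zero}  [ p ] _ = p , refl
  pathIn⇒reachIn≤ {m = suc _} [ p ] _ = p , inj₁ refl
  pathIn⇒reachIn≤ {m = suc _} (p ∷⟨ e ⟩ π) (s≤s k≤m) = p , inj₂ (_ , e , pathIn⇒reachIn≤ π k≤m)

  reach? : Decidable P → ∀ a b → Dec (ReachIn G P a b)
  reach? P? a b = map′ (reachIn≤⇒reach n) shorten (reachIn≤? P? n a b)
    where
    shorten : ReachIn G _ a b → ReachIn≤ n _ a b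
    shorten r with reach⇒simplePath r
    ... | simplePath π u = pathIn⇒reachIn≤ π (<⇒≤ (unique⇒length≤n u))

  cycle-closing : ¬ P u → u ~ a → u ~ b → a ≢ b → ReachIn G P a b → Cycle G
  cycle-closing {P = P} {u} {a} {b} ¬Pu ua ub a≢b r with reach⇒simplePath r
  ... | simplePath [ _ ] _ = contradiction refl a≢b
  ... | simplePath {k = suc k} {vs} π@(_ ∷⟨ _ ⟩ _) uniq =
    k , lookup (u ∷ vs) , (λ {i} {j} → lookup-injective (u∉π ∷ uniq) i j) , adjacent ,
    subst (_~ u) (sym (pathIn-last π)) (~-sym ub)
    where
    u∉π : All (u ≢_) vs
    u∉π = All.map (λ p u≡ → ¬Pu (subst P (sym u≡) p)) (pathIn-all π)
    adjacent : ∀ i → lookup (u ∷ vs) (inject₁ i) ~ lookup (u ∷ vs) (suc i)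
    adjacent zero    = subst (u ~_) (sym (pathIn-head π)) ua
    adjacent (suc i) = pathIn-adjacent π i

  data LastOrInject₁ : Fin (suc m) → Set where
    last    : LastOrInject₁ (fromℕ m)
    inject  : (s : Fin m) → LastOrInject₁ (inject₁ s)

  lastOrInject₁ : (t : Fin (suc m)) → LastOrInject₁ t
  lastOrInject₁ {zero}  zero    = last
  lastOrInject₁ {suc _} zero    = inject zero
  lastOrInject₁ {suc _} (suc t) with lastOrInject₁ t
  ... | last      = last
  ... | inject s = inject (suc s)

  inject₁²≢suc² : (s : Fin m) → inject₁ (inject₁ s) ≢ suc (suc s)
  inject₁²≢suc² zero    ()
  inject₁²≢suc² (suc s) eq = inject₁²≢suc² s (suc-injective eq)

  cycle-neighbours : (v : Fin (suc (suc (suc k))) → Fin n) →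
                     (∀ i → v (inject₁ i) ~ v (suc i)) → v (fromℕ (suc (suc k))) ~ v zero →
                     ∀ i → ∃₂ λ j j′ → j ≢ j′ × v j ~ v i × v j′ ~ v i
  cycle-neighbours v adj close zero = suc zero , fromℕ _ , (λ ()) , ~-sym (adj zero) , close
  cycle-neighbours {k} v adj close (suc t) with lastOrInject₁ t
  ... | last      = inject₁ (fromℕ (suc k)) , zero , (λ ()) , adj (fromℕ (suc k)) , ~-sym close
  ... | inject s  = inject₁ (inject₁ s) , suc (suc s) , inject₁²≢suc² s , adj (inject₁ s) , ~-sym (adj (suc s))

  -- Forcing from a single vertex

  SoleWhiteNeighbour : Subset n → Fin n → Fin n → Set
  SoleWhiteNeighbour B u w = ∀ x → WhiteComp G B w x → u ~ x → x ≡ w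

  Stalled : Subset n → Set
  Stalled B = ∀ C → ¬ PSDForce G B C

  SingleAttachment : Subset n → Set
  SingleAttachment B = ∀ {w w′ x x′} → WhiteComp G B w w′ → x ∈ B → x ~ w → x′ ∈ B → x′ ~ w′ → x ≡ x′

  Acyclic : Subset n → Set
  Acyclic B = (c : Cycle G) → ¬ (∀ i → proj₁ (proj₂ c) i ∈ B)

  force-⊆ : PSDForce G B C → B ⊆ C
  force-⊆ (force _ w _ _ _ _) = p⊆p∪q ⁅ w ⁆

  whiteComp-⊆ : B ⊆ C → WhiteComp G C x y → WhiteComp G B x y
  whiteComp-⊆ B⊆C = reach-map (λ z∉C z∈B → z∉C (B⊆C z∈B))

  PSDReach-preserves : {I : Subset n → Set} → (∀ {B C} → I B → PSDForce G B C → I C) →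
                       I B → PSDReach G B C → I C
  PSDReach-preserves keep i done       = i
  PSDReach-preserves keep i (more f r) = PSDReach-preserves keep (keep i f) r

  -- x would be u, so v would be a white neighbour of u in the old component of w, i.e. v = w.
  forced-component-sealed : SingleAttachment B → u ∈ B → w ∉ B → u ~ w → SoleWhiteNeighbour B u w →
                            WhiteComp G (B ∪ ⁅ w ⁆) y v → w ~ y → x ∈ B → x ~ v → ⊥
  forced-component-sealed {B} {w = w} {v = v} sa u∈B w∉B uw sole comp wy x∈B xv =
    reach-last comp (subst (_∈ B ∪ ⁅ w ⁆) (sym v≡w) x∈p∪⁅x⁆)
    where
    comp′ : WhiteComp G B w v
    comp′ = step w∉B wy (whiteComp-⊆ (p⊆p∪q ⁅ w ⁆) comp)
    v≡w : v ≡ w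
    v≡w = sole v comp′ (subst (_~ v) (sym (sa comp′ u∈B uw x∈B xv)) xv)

  singleAttachment-force : SingleAttachment B → PSDForce G B C → SingleAttachment C
  singleAttachment-force {B} sa (force u w u∈B w∉B uw sole) comp x∈C xy x′∈C x′y′
    with x∈p∪⁅y⁆⁻ x∈C | x∈p∪⁅y⁆⁻ x′∈C
  ... | inj₁ x∈B | inj₁ x′∈B = sa (whiteComp-⊆ (p⊆p∪q ⁅ w ⁆) comp) x∈B xy x′∈B x′y′
  ... | inj₂ refl | inj₂ refl = refl
  ... | inj₂ refl | inj₁ x′∈B = ⊥-elim (forced-component-sealed sa u∈B w∉B uw sole comp xy x′∈B x′y′)
  ... | inj₁ x∈B | inj₂ refl = ⊥-elim (forced-component-sealed sa u∈B w∉B uw sole (reach-sym comp) x′y′ x∈B xy)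

  -- A new cycle would pass through the forced vertex w, whose two cycle neighbours
  -- are then distinct blue vertices attached to the white component {w}.
  acyclic-force : SingleAttachment B → PSDForce G B C → Acyclic B → Acyclic C
  acyclic-force {B} sa (force _ w _ w∉B _ _) acyclic c@(_ , v , inj , adj , close) all∈C = acyclic c all∈B
    where
    ∈B : ∀ i → v i ~ w → v i ∈ B
    ∈B i viw with x∈p∪⁅y⁆⁻ (all∈C i)
    ... | inj₁ vi∈B = vi∈B
    ... | inj₂ vi≡w = contradiction vi≡w (~-irrefl viw)
    all∈B : ∀ i → v i ∈ B
    all∈B i with x∈p∪⁅y⁆⁻ (all∈C i)
    ... | inj₁ vi∈B = vi∈B
    ... | inj₂ refl with cycle-neighbours v adj close i
    ...   | j , j′ , j≢j′ , vj~ , vj′~ = ⊥-elim (j≢j′ (inj (sa (here w∉B) (∈B j vj~) vj~ (∈B j′ vj′~) vj′~)))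

  record BlueTree (y : Fin n) (B : Subset n) : Set where
    field
      root∈            : y ∈ B
      connected        : t ∈ B → ReachIn G (_∈ B) y t
      acyclic          : Acyclic B
      singleAttachment : SingleAttachment B
  open BlueTree

  blueTree-⁅⁆ : BlueTree y ⁅ y ⁆
  blueTree-⁅⁆ {y} = record
    { root∈            = x∈⁅x⁆ y
    ; connected        = λ t∈ → subst (ReachIn G _ y) (sym (x∈⁅y⁆⇒x≡y y t∈)) (here (x∈⁅x⁆ y))
    ; acyclic          = λ (_ , v , inj , _) all∈ →
                           case inj (trans (x∈⁅y⁆⇒x≡y y (all∈ zero)) (sym (x∈⁅y⁆⇒x≡y y (all∈ (suc zero)))))
                           of λ ()
    ; singleAttachment = λ _ x∈ _ x′∈ _ → trans (x∈⁅y⁆⇒x≡y y x∈) (sym (x∈⁅y⁆⇒x≡y y x′∈))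
    }

  blueTree-force : BlueTree y B → PSDForce G B C → BlueTree y C
  blueTree-force {y} {B} T f@(force u w u∈B _ uw _) = record
    { root∈            = force-⊆ f (root∈ T)
    ; connected        = connected′
    ; acyclic          = acyclic-force (singleAttachment T) f (acyclic T)
    ; singleAttachment = singleAttachment-force (singleAttachment T) f
    }
    where
    connected′ : t ∈ B ∪ ⁅ w ⁆ → ReachIn G (_∈ B ∪ ⁅ w ⁆) y t
    connected′ t∈C with x∈p∪⁅y⁆⁻ t∈C
    ... | inj₁ t∈B = reach-map (force-⊆ f) (connected T t∈B)
    ... | inj₂ refl = reach-snoc (reach-map (force-⊆ f) (connected T u∈B)) uw x∈p∪⁅x⁆

  blueTree-reach : PSDReach G ⁅ y ⁆ B → BlueTree y B
  blueTree-reach = PSDReach-preserves blueTree-force blueTree-⁅⁆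

  blueTree-spanning⇒tree : BlueTree y B → (∀ x → x ∈ B) → IsTree G
  blueTree-spanning⇒tree T all∈ =
    (λ a b → reach-trans (reach-sym (toWalk (connected T (all∈ a)))) (toWalk (connected T (all∈ b)))) ,
    λ c → acyclic T c (λ _ → all∈ _)
    where
    toWalk : ReachIn G P a b → ReachIn G (λ _ → Unit) a b
    toWalk = reach-map (λ _ → tt)

  singleton-forcing⇒tree : IsPSDForcingSet G ⁅ y ⁆ → IsTree G
  singleton-forcing⇒tree r = blueTree-spanning⇒tree (blueTree-reach r) (λ _ → ∈⊤)

  force-grows : PSDForce G B C → ∣ B ∣ < ∣ C ∣
  force-grows (force _ w _ w∉B _ _) = p⊂q⇒∣p∣<∣q∣ (p⊆p∪q ⁅ w ⁆ , w , x∈p∪⁅x⁆ , w∉B)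

  forcing-wellFounded : WellFounded (flip (PSDForce G))
  forcing-wellFounded =
    Subrelation.wellFounded (λ {C} f → ∸-monoʳ-< (force-grows f) (∣p∣≤n C))
                            (On.wellFounded (λ B → n ∸ ∣ B ∣) <-wellFounded)

  -- Double negation spares deciding whether some force is available.
  stalled-closure : ∀ S → ¬ ¬ (∃[ B ] (PSDReach G S B × Stalled B))
  stalled-closure S = go (forcing-wellFounded S)
    where
    go : Acc (flip (PSDForce G)) C → ¬ ¬ (∃[ B ] (PSDReach G C B × Stalled B))
    go {C} (acc rs) none = none (C , done , λ _ f → go (rs f) λ (B , r , st) → none (B , more f r , st))

  tree⇒soleWhiteNeighbour : IsTree G → u ∈ B → u ~ w → SoleWhiteNeighbour B u w
  tree⇒soleWhiteNeighbour tree u∈B uw x comp ux with x ≟ _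
  ... | yes x≡w = x≡w
  ... | no  x≢w = ⊥-elim (proj₂ tree (cycle-closing (λ u∉B → u∉B u∈B) uw ux (x≢w ∘ sym) comp))

  tree⇒force-exists : IsTree G → x ∈ B → y ∉ B → ∃ (PSDForce G B)
  tree⇒force-exists tree x∈B y∉B with reach-exit (proj₁ tree _ _) y∉B x∈B
  ... | w , u , r , wu , u∈B , _ =
    _ , force u w u∈B (proj₂ (reach-last r)) (~-sym wu) (tree⇒soleWhiteNeighbour tree u∈B (~-sym wu))

  tree⇒singleton-forcing : IsTree G → ∀ x → IsPSDForcingSet G ⁅ x ⁆
  tree⇒singleton-forcing tree x = go (forcing-wellFounded ⁅ x ⁆) (x∈⁅x⁆ x)
    where
    go : Acc (flip (PSDForce G)) B → x ∈ B → PSDReach G B (full G)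
    go {B} (acc rs) x∈B with ∀∈⊎∃∉ B
    ... | inj₁ all∈ = subst (PSDReach G B) (⊆-antisym ⊆⊤ (λ {y} _ → all∈ y)) done
    ... | inj₂ (_ , y∉B) with tree⇒force-exists tree x∈B y∉B
    ...   | _ , f = more f (go (rs f) (force-⊆ f x∈B))

  -- PSD forts

  -- The forcing vertex would be the only neighbour of w in the fort component of w.
  PSDFort-stays-white : IsPSDFort G F → Disjoint F B → PSDForce G B C → Disjoint F C
  PSDFort-stays-white {F} {B} fort F∩B=∅ (force u w u∈B w∉B uw sole) {x} x∈F x∈C with x∈p∪⁅y⁆⁻ x∈C
  ... | inj₁ x∈B = F∩B=∅ x∈F x∈B
  ... | inj₂ refl = proj₂ (proj₂ fort x x∈F) u u∉K (x , here x∈F , uw , only-x)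
    where
    u∉K : ¬ ReachIn G (_∈ F) x u
    u∉K r = F∩B=∅ (reach-last r) u∈B
    only-x : ∀ x′ → ReachIn G (_∈ F) x x′ → u ~ x′ → x′ ≡ x
    only-x x′ r = sole x′ (reach-map F∩B=∅ r)

  PSDFort-meets-forcingSet : IsPSDFort G F → IsPSDForcingSet G S → ¬ Disjoint F S
  PSDFort-meets-forcingSet fort r F∩S=∅ with proj₁ fort
  ... | x , x∈F = PSDReach-preserves (PSDFort-stays-white fort) F∩S=∅ r x∈F ∈⊤

  tree⇒PSDFort-full : IsTree G → IsPSDFort G F → ∀ x → x ∈ F
  tree⇒PSDFort-full {F} tree fort x = decidable-stable (x ∈? F) λ x∉F →
    PSDFort-meets-forcingSet fort (tree⇒singleton-forcing tree x)
      λ z∈F z∈⁅x⁆ → x∉F (subst (_∈ F) (x∈⁅y⁆⇒x≡y x z∈⁅x⁆) z∈F)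

  -- A blue vertex with exactly one neighbour in a white component could force it.
  stalled⇒component-isFort : Stalled B → a ∉ B → IsFort G (ReachIn G (_∈ ∁ B) a)
  stalled⇒component-isFort {B} {a} stalled a∉B =
    (a , here (x∉p⇒x∈∁p a∉B)) , λ v v∉K (w , r , vw , only-w) → case v ∈? B of λ where
      (no  v∉B) → v∉K (reach-snoc r (~-sym vw) (x∉p⇒x∈∁p v∉B))
      (yes v∈B) → stalled _ (force v w v∈B (x∈∁p⇒x∉p (reach-last r)) vw
                    λ w′ comp → only-w w′ (reach-trans r (reach-map x∉p⇒x∈∁p comp)))

  stalled⇒∁-PSDFort : Stalled B → x ∉ B → IsPSDFort G (∁ B)
  stalled⇒∁-PSDFort stalled x∉B =
    (_ , x∉p⇒x∈∁p x∉B) , λ _ a∈∁B → stalled⇒component-isFort stalled (x∈∁p⇒x∉p a∈∁B)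

  ⊤-isPSDFort : Fin n → IsPSDFort G ⊤
  ⊤-isPSDFort x =
    (x , ∈⊤) , λ a _ → (a , here ∈⊤) , λ v v∉K (w , r , vw , _) → v∉K (reach-snoc r (~-sym vw) ∈⊤)

  ⁅x⁆-isZIrSet : ∀ x → IsZIrSet G ⁅ x ⁆
  ⁅x⁆-isZIrSet x t t∈⁅x⁆ with refl ← x∈⁅y⁆⇒x≡y x t∈⁅x⁆ =
    ⊤ , ⊤-isPSDFort x , p∩q≡⁅x⁆ (x∈⁅x⁆ x) ∈⊤ (λ y∈⁅x⁆ _ → x∈⁅y⁆⇒x≡y x y∈⁅x⁆)

  tree⇒ZIrSet-subsingleton : IsTree G → IsZIrSet G S → x ∈ S → y ∈ S → x ≡ y
  tree⇒ZIrSet-subsingleton {S} {x} {y} tree zS x∈S y∈S with zS x x∈S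
  ... | F , fort , S∩F≡⁅x⁆ =
    sym (x∈⁅y⁆⇒x≡y x (subst (y ∈_) S∩F≡⁅x⁆ (x∈p∩q⁺ (y∈S , tree⇒PSDFort-full tree fort y))))

  stalled-pair-isZIrSet : Stalled B → Stalled C → u ∈ B → v ∈ C → v ∉ B → u ∉ C →
                          IsZIrSet G (⁅ u ⁆ ∪ ⁅ v ⁆)
  stalled-pair-isZIrSet {B} {C} {u} {v} stB stC u∈B v∈C v∉B u∉C t t∈ with x∈p∪⁅y⁆⁻ t∈
  ... | inj₁ t∈⁅u⁆ with refl ← x∈⁅y⁆⇒x≡y u t∈⁅u⁆ = ∁ C , stalled⇒∁-PSDFort stC u∉C , ⁅x⁆∪⁅y⁆∩∁p≡⁅x⁆ u∉C v∈C
  ... | inj₂ refl = ∁ B , stalled⇒∁-PSDFort stB v∉B ,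
                    trans (cong (_∩ ∁ B) (∪-comm ⁅ u ⁆ ⁅ v ⁆)) (⁅x⁆∪⁅y⁆∩∁p≡⁅x⁆ v∉B u∈B)

  -- Graphs that are not trees

  stalled⇒second-neighbour : Stalled B → b ∈ B → y ∉ B → b ~ y →
                              ∃[ x ] (WhiteComp G B y x × b ~ x × x ≢ y)
  stalled⇒second-neighbour {B} {b} {y} stalled b∈B y∉B by
    with any? (λ x → reach? (λ z → ¬? (z ∈? B)) y x ×-dec (b ~? x) ×-dec ¬? (x ≟ y))
  ... | yes found = found
  ... | no  none  = ⊥-elim (stalled _ (force b y b∈B y∉B by sole))
    where
    sole : SoleWhiteNeighbour B b y
    sole x comp bx = decidable-stable (x ≟ y) λ x≢y → none (x , comp , bx , x≢y)

  -- If x is white, the walk leaves the white component of w through a blue vertex, which must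
  -- be u; this gives u a second white neighbour in that component.
  forcer-only-exit : SingleAttachment B → u ∈ B → w ∉ B → u ~ w → SoleWhiteNeighbour B u w →
                     w ~ x → ReachIn G (_≢ w) x t → t ∈ B → x ≡ u
  forcer-only-exit {B} {w = w} {x = x} sa u∈B w∉B uw sole wx r t∈B with x ∈? B
  ... | yes x∈B = sym (sa (here w∉B) u∈B uw x∈B (~-sym wx))
  ... | no  x∉B with reach-exit r x∉B t∈B
  ...   | c , b , r′ , cb , b∈B , _ = ⊥-elim (proj₁ (reach-last r′) c≡w)
    where
    comp : WhiteComp G B _ c
    comp = step w∉B wx (reach-map proj₂ r′)
    c≡w : c ≡ w
    c≡w = sole c comp (subst (_~ c) (sym (sa comp u∈B uw b∈B (~-sym cb))) (~-sym cb))

  -- b cannot be forced: the forcing vertex would equal both of its neighbours x and y.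
  force-spares : SingleAttachment B → y ∈ B → b ~ x → b ~ y → x ≢ y → ReachIn G (_≢ b) x y →
                 PSDForce G B C → b ∉ B → b ∉ C
  force-spares sa y∈B bx by x≢y r (force u w u∈B w∉B uw sole) b∉B b∈C with x∈p∪⁅y⁆⁻ b∈C
  ... | inj₁ b∈B = b∉B b∈B
  ... | inj₂ refl = x≢y (trans (forcer-only-exit sa u∈B w∉B uw sole bx r y∈B)
                               (sa (here w∉B) u∈B uw y∈B (~-sym by)))

  closure-spares : b ~ x → b ~ y → x ≢ y → ReachIn G (_≢ b) x y → PSDReach G ⁅ y ⁆ C → b ∉ C
  closure-spares {b} {y = y} bx by x≢y r ry = proj₂ (PSDReach-preserves keep (blueTree-⁅⁆ , b∉⁅y⁆) ry)
    where
    b∉⁅y⁆ : b ∉ ⁅ y ⁆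
    b∉⁅y⁆ b∈⁅y⁆ = ~-irrefl by (x∈⁅y⁆⇒x≡y y b∈⁅y⁆)
    keep : BlueTree y B × b ∉ B → PSDForce G B C → BlueTree y C × b ∉ C
    keep (T , b∉B) f = blueTree-force T f , force-spares (singleAttachment T) (root∈ T) bx by x≢y r f b∉B

  -- The walk could only enter B through b, the unique blue neighbour of the white component of y.
  avoiding-attachment⇒white : SingleAttachment B → b ∈ B → b ~ y → y ∉ B → b ∉ C →
                              ReachIn G (_∈ C) y t → t ∉ B
  avoiding-attachment⇒white sa b∈B by y∉B b∉C r t∈B with reach-exit r y∉B t∈B
  ... | c , b′ , r′ , cb′ , b′∈B , b′∈C =
    b∉C (subst (_∈ _) (sym (sa (reach-map proj₂ r′) b∈B by b′∈B (~-sym cb′))) b′∈C)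

  ZIrPartner : Fin n → Set
  ZIrPartner u = ∃[ v ] (v ≢ u × IsZIrSet G (⁅ u ⁆ ∪ ⁅ v ⁆))

  partner-outside-stalled : Stalled B → u ∈ B → v ∉ B → (∀ {C} → PSDReach G ⁅ v ⁆ C → u ∉ C) →
                            ¬ ¬ ZIrPartner u
  partner-outside-stalled {B} stB u∈B v∉B u∉closure none = stalled-closure ⁅ _ ⁆ λ (C , rv , stC) →
    none (_ , (λ v≡u → v∉B (subst (_∈ B) (sym v≡u) u∈B)) ,
          stalled-pair-isZIrSet stB stC u∈B (root∈ (blueTree-reach rv)) v∉B (u∉closure rv))

  -- The closure of y never colours the blue neighbour b of y, hence never reaches B.
  partner-beyond-attachment : BlueTree u B → Stalled B → b ∈ B → y ∉ B → b ~ y → ¬ ¬ ZIrPartner u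
  partner-beyond-attachment {B = B} {b} T stalled b∈B y∉B by
    with stalled⇒second-neighbour stalled b∈B y∉B by
  ... | x , comp , bx , x≢y = partner-outside-stalled stalled (root∈ T) y∉B λ ry u∈C →
    avoiding-attachment⇒white (singleAttachment T) b∈B by y∉B
      (closure-spares bx by x≢y (reach-map avoid-b (reach-sym comp)) ry)
      (connected (blueTree-reach ry) u∈C) (root∈ T)
    where
    avoid-b : z ∉ B → z ≢ b
    avoid-b z∉B refl = z∉B b∈B

  stalled-partner : BlueTree u B → Stalled B → s ∉ B → ¬ ¬ ZIrPartner u
  stalled-partner {u} {B} {s} T stalled s∉B with reach? (λ _ → yes tt) s u
  ... | no ¬s⇝u = partner-outside-stalled stalled (root∈ T) s∉B
                    λ rs u∈C → ¬s⇝u (reach-map (λ _ → tt) (connected (blueTree-reach rs) u∈C))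
  ... | yes s⇝u with reach-exit s⇝u s∉B (root∈ T)
  ...   | y , b , r , yb , b∈B , _ = partner-beyond-attachment T stalled b∈B (proj₂ (reach-last r)) (~-sym yb)

  ¬tree⇒ZIrPartner : ¬ IsTree G → ∀ u → ¬ ¬ ZIrPartner u
  ¬tree⇒ZIrPartner ¬tree u none = stalled-closure ⁅ u ⁆ λ (B , ru , stalled) → case ∀∈⊎∃∉ B of λ where
    (inj₁ all∈)      → ¬tree (blueTree-spanning⇒tree (blueTree-reach ru) all∈)
    (inj₂ (s , s∉B)) → stalled-partner (blueTree-reach ru) stalled s∉B none

  tree-stable : ¬ ¬ IsTree G → IsTree G
  tree-stable ¬¬tree =
    (λ a b → decidable-stable (reach? (λ _ → yes tt) a b) (¬¬-map (λ tree → proj₁ tree a b) ¬¬tree)) ,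
    λ c → ¬¬tree (λ tree → proj₂ tree c)

  -- Characterisations of trees

  forcingSet-nonempty : Fin n → IsPSDForcingSet G S → Nonempty S
  forcingSet-nonempty x done                           = x , ∈⊤
  forcingSet-nonempty _ (more (force u _ u∈S _ _ _) _) = u , u∈S

  forcingSet-of-size-1⇒tree : IsPSDForcingSet G S → ∣ S ∣ ≡ 1 → IsTree G
  forcingSet-of-size-1⇒tree {S} r ∣S∣≡1 with ∣p∣≡1⇒singleton {p = S} ∣S∣≡1
  ... | _ , refl = singleton-forcing⇒tree r

  maximal-ZIrSet-nonempty : Fin n → Maximal (IsZIrSet G) S → Nonempty S
  maximal-ZIrSet-nonempty {S} o (_ , maximal) with nonempty? S
  ... | yes nonempty = nonempty
  ... | no  empty    =
    o , subst (o ∈_) (maximal ⁅ o ⁆ (λ x∈S → ⊥-elim (empty (_ , x∈S))) (⁅x⁆-isZIrSet o)) (x∈⁅x⁆ o)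

  tree⇔Zplus≡1 : Fin n → IsTree G ⇔ Zplus≡ G 1
  tree⇔Zplus≡1 o = mk⇔
    (λ tree → (⁅ o ⁆ , tree⇒singleton-forcing tree o , ∣⁅x⁆∣≡1 o) ,
              λ _ r → x∈p⇒1≤∣p∣ (proj₂ (forcingSet-nonempty o r)))
    (λ ((_ , r , ∣S∣≡1) , _) → forcingSet-of-size-1⇒tree r ∣S∣≡1)

  tree⇔ZplusBar≡1 : Fin n → IsTree G ⇔ ZplusBar≡ G 1
  tree⇔ZplusBar≡1 o = mk⇔
    (λ tree → (⁅ o ⁆ , (tree⇒singleton-forcing tree o , ⁅o⁆-minimal) , ∣⁅x⁆∣≡1 o) , bound tree)
    (λ ((_ , (r , _) , ∣S∣≡1) , _) → forcingSet-of-size-1⇒tree r ∣S∣≡1)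
    where
    ⁅o⁆-minimal : ∀ T → T ⊆ ⁅ o ⁆ → IsPSDForcingSet G T → T ≡ ⁅ o ⁆
    ⁅o⁆-minimal T T⊆⁅o⁆ r = p⊆⁅x⁆⇒p≡⁅x⁆ T⊆⁅o⁆ (proj₂ (forcingSet-nonempty o r))
    bound : IsTree G → ∀ S → Minimal (IsPSDForcingSet G) S → ∣ S ∣ ≤ 1
    bound tree S (r , minimal) with forcingSet-nonempty o r
    ... | x , x∈S = subst (λ T → ∣ T ∣ ≤ 1) (minimal ⁅ x ⁆ (x∈p⇒⁅x⁆⊆p x∈S) (tree⇒singleton-forcing tree x))
                          (≤-reflexive (∣⁅x⁆∣≡1 x))

  tree⇔ZplusIR≡1 : Fin n → IsTree G ⇔ ZplusIR≡ G 1
  tree⇔ZplusIR≡1 o = mk⇔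
    (λ tree → (⁅ o ⁆ , ⁅x⁆-isZIrSet o , ∣⁅x⁆∣≡1 o) ,
              λ _ zS → subsingleton⇒∣p∣≤1 (tree⇒ZIrSet-subsingleton tree zS))
    (λ (_ , bound) → tree-stable λ ¬tree → ¬tree⇒ZIrPartner ¬tree o λ (_ , v≢o , zS) →
       <⇒≱ (1<∣⁅x⁆∪⁅y⁆∣ v≢o) (bound _ zS))

  tree⇔zplusir≡1 : Fin n → IsTree G ⇔ zplusir≡ G 1
  tree⇔zplusir≡1 o = mk⇔
    (λ tree → (⁅ o ⁆ , (⁅x⁆-isZIrSet o , ⁅o⁆-maximal tree) , ∣⁅x⁆∣≡1 o) ,
              λ _ max → x∈p⇒1≤∣p∣ (proj₂ (maximal-ZIrSet-nonempty o max)))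
    from
    where
    ⁅o⁆-maximal : IsTree G → ∀ T → ⁅ o ⁆ ⊆ T → IsZIrSet G T → T ≡ ⁅ o ⁆
    ⁅o⁆-maximal tree T ⁅o⁆⊆T zT = p⊆⁅x⁆⇒p≡⁅x⁆
      (λ y∈T → subst (_∈ ⁅ o ⁆) (tree⇒ZIrSet-subsingleton tree zT (⁅o⁆⊆T (x∈⁅x⁆ o)) y∈T) (x∈⁅x⁆ o))
      (⁅o⁆⊆T (x∈⁅x⁆ o))
    from : zplusir≡ G 1 → IsTree G
    from ((S , (_ , maximal) , ∣S∣≡1) , _) with ∣p∣≡1⇒singleton {p = S} ∣S∣≡1
    ... | u , refl = tree-stable λ ¬tree → ¬tree⇒ZIrPartner ¬tree u λ (v , v≢u , zS) →
      v≢u (x∈⁅y⁆⇒x≡y u (subst (v ∈_) (maximal _ (p⊆p∪q ⁅ v ⁆) zS) (q⊆p∪q ⁅ u ⁆ ⁅ v ⁆ (x∈⁅x⁆ v))))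

corollary3p21 : ∀ (n : ℕ) (G : Graph n) → 2 ≤ n → HasEdge G →
    (IsTree G ⇔ zplusir≡ G 1) × (IsTree G ⇔ Zplus≡ G 1) ×
    (IsTree G ⇔ ZplusBar≡ G 1) × (IsTree G ⇔ ZplusIR≡ G 1)
corollary3p21 (suc _) G (s≤s _) _ =
  tree⇔zplusir≡1 G zero , tree⇔Zplus≡1 G zero , tree⇔ZplusBar≡1 G zero , tree⇔ZplusIR≡1 G zero
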